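{- Let $\mathcal{C}$ be a cd-category with effect conditioning. Then every state $\omega\colon I\to X\otimes Y$ satisfies $$\omega=(\mathrm{id}_X\otimes\omega|_X)\circ\Delta_X\circ\omega_X,$$ where $\omega_X:=(\mathrm{id}_X\otimes\epsilon_Y)\circ\omega$ is the marginal on $X$ and $\omega|_X\colon X\to Y$ is the conditional of $\sigma_{X,Y}\circ\omega\colon I\to Y\otimes X$ on $X$.
   Context: A cd-category is a symmetric monoidal category $(\mathcal{C},\otimes,I)$ (symmetry $\sigma$) in which every object $X$ carries $\Delta_X\colon X\to X\otimes X$ and $\epsilon_X\colon X\to I$ forming a commutative comonoid, compatible with the tensor ($\Delta_{X\otimes Y}=(\mathrm{id}\otimes\sigma\otimes\mathrm{id})\circ(\Delta_X\otimes\Delta_Y)$, $\epsilon_{X\otimes Y}=\epsilon_X\otimes\epsilon_Y$, $\Delta_I=\epsilon_I=\mathrm{id}_I$). A partial channel is $f\colon X\to Y$ with $f=(f\otimes(\epsilon_Y\circ f))\circ\Delta_X$. Effect conditioning: $\mathcal{C}$ has (i) normalisation: a partial channel $\mathrm{norm}(f)$ for each $f\colon X\to Y$ with $f=(\mathrm{norm}(f)\otimes(\epsilon_Y\circ f))\circ\Delta_X$, $\mathrm{norm}(f)=f$ for partial channels, $\mathrm{norm}(f\otimes g)=\mathrm{norm}(f)\otimes\mathrm{norm}(g)$, $\mathrm{norm}(\epsilon\circ f)=\epsilon\circ\mathrm{norm}(f)$, $\mathrm{norm}(f\circ\Delta_X)=\mathrm{norm}(f)\circ\Delta_X$ for $f\colon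 X\otimes X\to Y$; (ii) cancellative caps: effects $\cap_X\colon X\otimes X\to I$ that are symmetric, satisfy $\cap_X\circ\Delta_X=\epsilon_X$, $(\cap_X\otimes\mathrm{id})\circ(\mathrm{id}\otimes\Delta_X)=(\mathrm{id}\otimes\cap_X)\circ(\Delta_X\otimes\mathrm{id})$, are compatible with $\otimes$, and such that $(\mathrm{id}_B\otimes\cap_X)\circ(f\otimes\mathrm{id}_X)=(\mathrm{id}_B\otimes\cap_X)\circ(g\otimes\mathrm{id}_X)$ implies $f=g$ for $f,g\colon A\to B\otimes X$. Conditional: for $f\colon A\to Y\otimes Z$, $f|_Z:=\mathrm{norm}((\mathrm{id}_Y\otimes\cap_Z)\circ(f\otimes\mathrm{id}_Z))\colon A\otimes Z\to Y$; for $A=I$ this is a morphism $Z\to Y$. -}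

module Defs where

open import Level using (Level; suc; _⊔_)
open import Relation.Binary.PropositionalEquality using (_≡_)

record SymmetricMonoidalCategory (o ℓ : Level) : Set (suc (o ⊔ ℓ)) where
  infixr 9 _∘_
  infixr 10 _⊗₀_ _⊗₁_
  field
    Obj : Set o
    Hom : Obj → Obj → Set ℓ
    id  : ∀ {A} → Hom A A
    _∘_ : ∀ {A B C} → Hom B C → Hom A B → Hom A C
    identityˡ : ∀ {A B} {f : Hom A B} → id ∘ f ≡ f
    identityʳ : ∀ {A B} {f : Hom A B} → f ∘ id ≡ f
    assoc : ∀ {A B C D} {f : Hom A B} {g : Hom B C} {h : Hom C D} →
            (h ∘ g) ∘ f ≡ h ∘ (g ∘ f)
    _⊗₀_ : Obj → Obj → Obj
    I : Obj
    _⊗₁_ : ∀ {A B C D} → Hom A B → Hom C D → Hom (A ⊗₀ C) (B ⊗₀ D)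
    ⊗-id : ∀ {A B} → (id {A}) ⊗₁ (id {B}) ≡ id
    ⊗-∘ : ∀ {A B C D E F} {f : Hom A B} {g : Hom B C} {h : Hom D E} {k : Hom E F} →
          (g ∘ f) ⊗₁ (k ∘ h) ≡ (g ⊗₁ k) ∘ (f ⊗₁ h)
    α⇒ : ∀ {X Y Z} → Hom ((X ⊗₀ Y) ⊗₀ Z) (X ⊗₀ (Y ⊗₀ Z))
    α⇐ : ∀ {X Y Z} → Hom (X ⊗₀ (Y ⊗₀ Z)) ((X ⊗₀ Y) ⊗₀ Z)
    α-isoˡ : ∀ {X Y Z} → α⇐ {X} {Y} {Z} ∘ α⇒ ≡ id
    α-isoʳ : ∀ {X Y Z} → α⇒ {X} {Y} {Z} ∘ α⇐ ≡ id
    α-natural : ∀ {A B C D E F} {f : Hom A B} {g : Hom C D} {h : Hom E F} →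
                α⇒ ∘ ((f ⊗₁ g) ⊗₁ h) ≡ (f ⊗₁ (g ⊗₁ h)) ∘ α⇒
    λ⇒ : ∀ {X} → Hom (I ⊗₀ X) X
    λ⇐ : ∀ {X} → Hom X (I ⊗₀ X)
    λ-isoˡ : ∀ {X} → λ⇐ {X} ∘ λ⇒ ≡ id
    λ-isoʳ : ∀ {X} → λ⇒ {X} ∘ λ⇐ ≡ id
    λ-natural : ∀ {A B} {f : Hom A B} → λ⇒ ∘ (id ⊗₁ f) ≡ f ∘ λ⇒
    ρ⇒ : ∀ {X} → Hom (X ⊗₀ I) X
    ρ⇐ : ∀ {X} → Hom X (X ⊗₀ I)
    ρ-isoˡ : ∀ {X} → ρ⇐ {X} ∘ ρ⇒ ≡ id
    ρ-isoʳ : ∀ {X} → ρ⇒ {X} ∘ ρ⇐ ≡ id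
    ρ-natural : ∀ {A B} {f : Hom A B} → ρ⇒ ∘ (f ⊗₁ id) ≡ f ∘ ρ⇒
    pentagon : ∀ {W X Y Z} →
               (id {W} ⊗₁ α⇒ {X} {Y} {Z}) ∘ α⇒ ∘ (α⇒ ⊗₁ id) ≡ α⇒ ∘ α⇒
    triangle : ∀ {X Y} → (id {X} ⊗₁ λ⇒ {Y}) ∘ α⇒ ≡ ρ⇒ ⊗₁ id
    σ : ∀ {X Y} → Hom (X ⊗₀ Y) (Y ⊗₀ X)
    σ-natural : ∀ {A B C D} {f : Hom A B} {g : Hom C D} →
                σ ∘ (f ⊗₁ g) ≡ (g ⊗₁ f) ∘ σ
    σ-involutive : ∀ {X Y} → σ {Y} {X} ∘ σ {X} {Y} ≡ id
    hexagon : ∀ {X Y Z} →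
              (id {Y} ⊗₁ σ {X} {Z}) ∘ α⇒ ∘ (σ ⊗₁ id) ≡ α⇒ ∘ σ ∘ α⇒

  interchange : ∀ {A B C D} → Hom ((A ⊗₀ B) ⊗₀ (C ⊗₀ D)) ((A ⊗₀ C) ⊗₀ (B ⊗₀ D))
  interchange = α⇐ ∘ (id ⊗₁ (α⇒ ∘ (σ ⊗₁ id) ∘ α⇐)) ∘ α⇒

record CDCategory (o ℓ : Level) : Set (suc (o ⊔ ℓ)) where
  field
    smc : SymmetricMonoidalCategory o ℓ
  open SymmetricMonoidalCategory smc public
  field
    Δ : ∀ {X} → Hom X (X ⊗₀ X)
    ε : ∀ {X} → Hom X I
    counitˡ : ∀ {X} → (ε ⊗₁ id) ∘ Δ {X} ≡ λ⇐
    counitʳ : ∀ {X} → (id ⊗₁ ε) ∘ Δ {X} ≡ ρ⇐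
    coassoc : ∀ {X} → α⇒ ∘ (Δ ⊗₁ id) ∘ Δ {X} ≡ (id ⊗₁ Δ) ∘ Δ
    cocomm  : ∀ {X} → σ ∘ Δ {X} ≡ Δ
    Δ-⊗ : ∀ {X Y} → Δ {X ⊗₀ Y} ≡ interchange ∘ (Δ ⊗₁ Δ)
    ε-⊗ : ∀ {X Y} → ε {X ⊗₀ Y} ≡ λ⇒ ∘ (ε ⊗₁ ε)
    Δ-I : Δ {I} ≡ λ⇐
    ε-I : ε {I} ≡ id

  IsPartialChannel : ∀ {X Y} → Hom X Y → Set ℓ
  IsPartialChannel f = f ≡ ρ⇒ ∘ (f ⊗₁ (ε ∘ f)) ∘ Δ

record EffectConditioning {o ℓ : Level} (C : CDCategory o ℓ) : Set (o ⊔ ℓ) where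
  open CDCategory C
  field
    norm : ∀ {X Y} → Hom X Y → Hom X Y
    norm-partial : ∀ {X Y} (f : Hom X Y) → IsPartialChannel (norm f)
    norm-factor : ∀ {X Y} (f : Hom X Y) → f ≡ ρ⇒ ∘ (norm f ⊗₁ (ε ∘ f)) ∘ Δ
    norm-channel : ∀ {X Y} (f : Hom X Y) → IsPartialChannel f → norm f ≡ f
    norm-⊗ : ∀ {A B C D} (f : Hom A B) (g : Hom C D) →
             norm (f ⊗₁ g) ≡ norm f ⊗₁ norm g
    norm-ε : ∀ {X Y} (f : Hom X Y) → norm (ε ∘ f) ≡ ε ∘ norm f
    norm-Δ : ∀ {X Y} (f : Hom (X ⊗₀ X) Y) → norm (f ∘ Δ) ≡ norm f ∘ Δ
    cap : ∀ {X} → Hom (X ⊗₀ X) I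
    cap-sym : ∀ {X} → cap {X} ∘ σ ≡ cap
    cap-Δ : ∀ {X} → cap {X} ∘ Δ ≡ ε
    cap-snake : ∀ {X} → λ⇒ ∘ (cap ⊗₁ id) ∘ α⇐ ∘ (id ⊗₁ Δ {X})
                        ≡ ρ⇒ ∘ (id ⊗₁ cap) ∘ α⇒ ∘ (Δ {X} ⊗₁ id)
    cap-⊗ : ∀ {X Y} → cap {X ⊗₀ Y} ≡ λ⇒ ∘ (cap ⊗₁ cap) ∘ interchange
    cap-I : cap {I} ≡ λ⇒
    cap-cancel : ∀ {A B X} (f g : Hom A (B ⊗₀ X)) →
                 ρ⇒ ∘ (id ⊗₁ cap) ∘ α⇒ ∘ (f ⊗₁ id {X})
                   ≡ ρ⇒ ∘ (id ⊗₁ cap) ∘ α⇒ ∘ (g ⊗₁ id {X}) →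
                 f ≡ g

  conditional : ∀ {A Y Z} → Hom A (Y ⊗₀ Z) → Hom (A ⊗₀ Z) Y
  conditional f = norm (ρ⇒ ∘ (id ⊗₁ cap) ∘ α⇒ ∘ (f ⊗₁ id))

  stateConditional : ∀ {Y Z} → Hom I (Y ⊗₀ Z) → Hom Z Y
  stateConditional f = conditional f ∘ λ⇐

  marginal : ∀ {X Y} → Hom I (X ⊗₀ Y) → Hom I X
  marginal ω = ρ⇒ ∘ (id ⊗₁ ε) ∘ ω

-- Put τ = σ ∘ ω. Since caps are cancellative, τ is determined by the map
-- I ⊗ X → Y obtained by bending its X-output into an input with the cap, so
-- it suffices to compare that map with the one of (τ|_X ⊗ id) ∘ Δ ∘ ω_X.
-- By normalisation, the bent τ is τ|_X copied alongside the scalar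
-- d = ∩ ∘ (ω_X ⊗ id), because discarding Y from τ leaves ω_X; by the snake
-- identity for caps, the bent candidate is τ|_X applied after the same
-- scalar d. Cocommutativity of Δ matches the two, and σ transports the
-- resulting disintegration of τ back to ω.
module Submission where

open import Defs
open import Level using (Level)
open import Relation.Binary.PropositionalEquality
  using (_≡_; refl; sym; trans; cong; cong₂; module ≡-Reasoning)

module SymmetricMonoidalProperties {o ℓ} (M : SymmetricMonoidalCategory o ℓ) where
  open SymmetricMonoidalCategory M
  open ≡-Reasoning

  private
    variable
      A B Z : Obj
      a b c d f g h k p p⁻¹ q q⁻¹ : Hom A B

  infixr 4 refl⟩∘⟨_
  infixl 5 _⟩∘⟨refl

  refl⟩∘⟨_ : f ≡ g → h ∘ f ≡ h ∘ g
  refl⟩∘⟨_ {h = h} = cong (h ∘_)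

  _⟩∘⟨refl : f ≡ g → f ∘ h ≡ g ∘ h
  _⟩∘⟨refl {h = h} = cong (_∘ h)

  pullˡ : a ∘ b ≡ c → a ∘ (b ∘ f) ≡ c ∘ f
  pullˡ e = trans (sym assoc) (e ⟩∘⟨refl)

  pushˡ : a ∘ b ≡ c → c ∘ f ≡ a ∘ (b ∘ f)
  pushˡ e = sym (pullˡ e)

  pullʳ : a ∘ b ≡ c → (f ∘ a) ∘ b ≡ f ∘ c
  pullʳ e = trans assoc (refl⟩∘⟨ e)

  extendʳ : a ∘ b ≡ c ∘ d → a ∘ (b ∘ f) ≡ c ∘ (d ∘ f)
  extendʳ e = trans (pullˡ e) assoc

  split-epi-cancel : p ∘ p⁻¹ ≡ id → f ∘ p ≡ g ∘ p → f ≡ g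
  split-epi-cancel {p = p} {p⁻¹ = p⁻¹} {f = f} {g = g} inv e = begin
    f              ≡⟨ sym identityʳ ⟩
    f ∘ id         ≡⟨ refl⟩∘⟨ sym inv ⟩
    f ∘ p ∘ p⁻¹    ≡⟨ pullˡ e ⟩
    (g ∘ p) ∘ p⁻¹  ≡⟨ pullʳ inv ⟩
    g ∘ id         ≡⟨ identityʳ ⟩
    g              ∎

  split-mono-cancel : q⁻¹ ∘ q ≡ id → q ∘ f ≡ q ∘ g → f ≡ g
  split-mono-cancel {q⁻¹ = q⁻¹} {q = q} {f = f} {g = g} inv e = begin
    f              ≡⟨ sym identityˡ ⟩
    id ∘ f         ≡⟨ sym inv ⟩∘⟨refl ⟩
    (q⁻¹ ∘ q) ∘ f  ≡⟨ pullʳ e ⟩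
    q⁻¹ ∘ q ∘ g    ≡⟨ pullˡ inv ⟩
    id ∘ g         ≡⟨ identityˡ ⟩
    g              ∎

  inverse-square : q⁻¹ ∘ q ≡ id → p ∘ p⁻¹ ≡ id → q ∘ a ≡ b ∘ p → a ∘ p⁻¹ ≡ q⁻¹ ∘ b
  inverse-square {q⁻¹ = q⁻¹} {q = q} {p = p} {p⁻¹ = p⁻¹} {a = a} {b = b} invq invp e = begin
    a ∘ p⁻¹                ≡⟨ sym identityˡ ⟩
    id ∘ a ∘ p⁻¹           ≡⟨ sym invq ⟩∘⟨refl ⟩
    (q⁻¹ ∘ q) ∘ a ∘ p⁻¹    ≡⟨ pullʳ (pullˡ e) ⟩
    q⁻¹ ∘ (b ∘ p) ∘ p⁻¹    ≡⟨ refl⟩∘⟨ pullʳ invp ⟩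
    q⁻¹ ∘ b ∘ id           ≡⟨ refl⟩∘⟨ identityʳ ⟩
    q⁻¹ ∘ b                ∎

  ⊗-∘ˡ : (f ∘ g) ⊗₁ id {Z} ≡ (f ⊗₁ id) ∘ (g ⊗₁ id)
  ⊗-∘ˡ = trans (cong₂ _⊗₁_ refl (sym identityˡ)) ⊗-∘

  ⊗-∘ʳ : id {Z} ⊗₁ (f ∘ g) ≡ (id ⊗₁ f) ∘ (id ⊗₁ g)
  ⊗-∘ʳ = trans (cong₂ _⊗₁_ (sym identityˡ) refl) ⊗-∘

  ⊗-splitˡ : f ⊗₁ g ≡ (f ⊗₁ id) ∘ (id ⊗₁ g)
  ⊗-splitˡ = trans (cong₂ _⊗₁_ (sym identityʳ) (sym identityˡ)) ⊗-∘

  ⊗-splitʳ : f ⊗₁ g ≡ (id ⊗₁ g) ∘ (f ⊗₁ id)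
  ⊗-splitʳ = trans (cong₂ _⊗₁_ (sym identityˡ) (sym identityʳ)) ⊗-∘

  ⊗-commute : (f ⊗₁ id) ∘ (id ⊗₁ g) ≡ (id ⊗₁ g) ∘ (f ⊗₁ id)
  ⊗-commute = trans (sym ⊗-splitˡ) ⊗-splitʳ

  ⊗-inverse : f ∘ g ≡ id → h ∘ k ≡ id → (f ⊗₁ h) ∘ (g ⊗₁ k) ≡ id
  ⊗-inverse e e′ = trans (sym ⊗-∘) (trans (cong₂ _⊗₁_ e e′) ⊗-id)

  λ⇐-natural : (id ⊗₁ f) ∘ λ⇐ ≡ λ⇐ ∘ f
  λ⇐-natural = inverse-square λ-isoˡ λ-isoʳ λ-natural

  α⇐-natural : α⇐ ∘ (f ⊗₁ (g ⊗₁ h)) ≡ ((f ⊗₁ g) ⊗₁ h) ∘ α⇐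
  α⇐-natural = sym (inverse-square α-isoˡ α-isoʳ α-natural)

  α⇒∘ρ⇐⊗id : α⇒ ∘ (ρ⇐ ⊗₁ id) ≡ id {A} ⊗₁ λ⇐ {B}
  α⇒∘ρ⇐⊗id = split-mono-cancel (⊗-inverse identityˡ λ-isoˡ) (begin
    (id ⊗₁ λ⇒) ∘ α⇒ ∘ (ρ⇐ ⊗₁ id)  ≡⟨ pullˡ triangle ⟩
    (ρ⇒ ⊗₁ id) ∘ (ρ⇐ ⊗₁ id)       ≡⟨ ⊗-inverse ρ-isoʳ identityˡ ⟩
    id                             ≡⟨ sym (⊗-inverse identityˡ λ-isoʳ) ⟩
    (id ⊗₁ λ⇒) ∘ (id ⊗₁ λ⇐)       ∎)

  id⊗-injective : id {I} ⊗₁ f ≡ id ⊗₁ g → f ≡ g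
  id⊗-injective e = split-epi-cancel λ-isoʳ
    (trans (sym λ-natural) (trans (refl⟩∘⟨ e) λ-natural))

  λ⇒∘α⇒ : λ⇒ {A ⊗₀ B} ∘ α⇒ {I} ≡ λ⇒ ⊗₁ id
  λ⇒∘α⇒ = id⊗-injective (split-epi-cancel α⇒∘α⇒⊗id-inverse (begin
    (id ⊗₁ (λ⇒ ∘ α⇒)) ∘ α⇒ ∘ (α⇒ ⊗₁ id)              ≡⟨ ⊗-∘ʳ ⟩∘⟨refl ⟩
    ((id ⊗₁ λ⇒) ∘ (id ⊗₁ α⇒)) ∘ α⇒ ∘ (α⇒ ⊗₁ id)      ≡⟨ pullʳ pentagon ⟩
    (id ⊗₁ λ⇒) ∘ α⇒ ∘ α⇒                              ≡⟨ pullˡ triangle ⟩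
    (ρ⇒ ⊗₁ id) ∘ α⇒                                   ≡⟨ cong (ρ⇒ ⊗₁_) (sym ⊗-id) ⟩∘⟨refl ⟩
    (ρ⇒ ⊗₁ (id ⊗₁ id)) ∘ α⇒                           ≡⟨ sym α-natural ⟩
    α⇒ ∘ ((ρ⇒ ⊗₁ id) ⊗₁ id)                           ≡⟨ refl⟩∘⟨ cong (_⊗₁ id) (sym triangle) ⟩
    α⇒ ∘ (((id ⊗₁ λ⇒) ∘ α⇒) ⊗₁ id)                    ≡⟨ refl⟩∘⟨ ⊗-∘ˡ ⟩
    α⇒ ∘ ((id ⊗₁ λ⇒) ⊗₁ id) ∘ (α⇒ ⊗₁ id)              ≡⟨ extendʳ α-natural ⟩
    (id ⊗₁ (λ⇒ ⊗₁ id)) ∘ α⇒ ∘ (α⇒ ⊗₁ id)              ∎))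
    where
    α⇒∘α⇒⊗id-inverse : (α⇒ ∘ (α⇒ ⊗₁ id)) ∘ (α⇐ ⊗₁ id) ∘ α⇐ ≡ id {I ⊗₀ ((I ⊗₀ A) ⊗₀ B)}
    α⇒∘α⇒⊗id-inverse = begin
      (α⇒ ∘ (α⇒ ⊗₁ id)) ∘ (α⇐ ⊗₁ id) ∘ α⇐  ≡⟨ pullʳ (pullˡ (⊗-inverse α-isoʳ identityˡ)) ⟩
      α⇒ ∘ id ∘ α⇐                          ≡⟨ refl⟩∘⟨ identityˡ ⟩
      α⇒ ∘ α⇐                               ≡⟨ α-isoʳ ⟩
      id                                    ∎

  α⇒∘λ⇐⊗id : α⇒ ∘ (λ⇐ ⊗₁ id) ≡ λ⇐ {A ⊗₀ B}
  α⇒∘λ⇐⊗id = trans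
    (inverse-square λ-isoˡ (⊗-inverse λ-isoʳ identityˡ) (trans λ⇒∘α⇒ (sym identityˡ)))
    identityʳ

  α⇐∘λ⇐ : α⇐ ∘ λ⇐ {A ⊗₀ B} ≡ λ⇐ ⊗₁ id
  α⇐∘λ⇐ = begin
    α⇐ ∘ λ⇐                  ≡⟨ refl⟩∘⟨ sym α⇒∘λ⇐⊗id ⟩
    α⇐ ∘ α⇒ ∘ (λ⇐ ⊗₁ id)     ≡⟨ pullˡ α-isoˡ ⟩
    id ∘ (λ⇐ ⊗₁ id)          ≡⟨ identityˡ ⟩
    λ⇐ ⊗₁ id                 ∎

module CDProperties {o ℓ} (𝒞 : CDCategory o ℓ) where
  open CDCategory 𝒞
  open SymmetricMonoidalProperties smc
  open ≡-Reasoning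

  private
    variable
      A X Y : Obj

  Δ-I≡ρ⇐ : Δ {I} ≡ ρ⇐
  Δ-I≡ρ⇐ = begin
    Δ                ≡⟨ sym identityˡ ⟩
    id ∘ Δ           ≡⟨ sym ⊗-id ⟩∘⟨refl ⟩
    (id ⊗₁ id) ∘ Δ   ≡⟨ cong (id ⊗₁_) (sym ε-I) ⟩∘⟨refl ⟩
    (id ⊗₁ ε) ∘ Δ    ≡⟨ counitʳ ⟩
    ρ⇐               ∎

  ρ⇒∘λ⇐ : ρ⇒ {I} ∘ λ⇐ ≡ id
  ρ⇒∘λ⇐ = trans (refl⟩∘⟨ trans (sym Δ-I) Δ-I≡ρ⇐) ρ-isoʳ

  σ∘ρ⇐ : σ ∘ ρ⇐ {A} ≡ λ⇐
  σ∘ρ⇐ = begin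
    σ ∘ ρ⇐                ≡⟨ refl⟩∘⟨ sym counitʳ ⟩
    σ ∘ (id ⊗₁ ε) ∘ Δ     ≡⟨ extendʳ σ-natural ⟩
    (ε ⊗₁ id) ∘ σ ∘ Δ     ≡⟨ refl⟩∘⟨ cocomm ⟩
    (ε ⊗₁ id) ∘ Δ         ≡⟨ counitˡ ⟩
    λ⇐                    ∎

  σ∘λ⇐ : σ ∘ λ⇐ {A} ≡ ρ⇐
  σ∘λ⇐ = begin
    σ ∘ λ⇐          ≡⟨ refl⟩∘⟨ sym σ∘ρ⇐ ⟩
    σ ∘ σ ∘ ρ⇐      ≡⟨ pullˡ σ-involutive ⟩
    id ∘ ρ⇐         ≡⟨ identityˡ ⟩
    ρ⇐              ∎

  λ⇒∘σ : λ⇒ ∘ σ {A} ≡ ρ⇒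
  λ⇒∘σ = split-epi-cancel ρ-isoˡ (begin
    (λ⇒ ∘ σ) ∘ ρ⇐   ≡⟨ pullʳ σ∘ρ⇐ ⟩
    λ⇒ ∘ λ⇐         ≡⟨ λ-isoʳ ⟩
    id              ≡⟨ sym ρ-isoʳ ⟩
    ρ⇒ ∘ ρ⇐         ∎)

  interchange∘λ⇐ : ∀ {A} → interchange ∘ (λ⇐ ⊗₁ id) ∘ λ⇐ ≡ λ⇐ {A} ⊗₁ λ⇐ {A}
  interchange∘λ⇐ {A} = begin
    interchange ∘ (λ⇐ ⊗₁ id) ∘ λ⇐   ≡⟨ pullʳ (pullʳ (pullˡ α⇒∘λ⇐⊗id)) ⟩
    α⇐ ∘ (id ⊗₁ middle) ∘ λ⇐ ∘ λ⇐   ≡⟨ refl⟩∘⟨ pullˡ λ⇐-natural ⟩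
    α⇐ ∘ (λ⇐ ∘ middle) ∘ λ⇐         ≡⟨ refl⟩∘⟨ pullʳ middle∘λ⇐ ⟩
    α⇐ ∘ λ⇐ ∘ (id ⊗₁ λ⇐)            ≡⟨ pullˡ α⇐∘λ⇐ ⟩
    (λ⇐ ⊗₁ id) ∘ (id ⊗₁ λ⇐)         ≡⟨ sym ⊗-splitˡ ⟩
    λ⇐ ⊗₁ λ⇐                        ∎
    where
    middle : Hom (I ⊗₀ (A ⊗₀ A)) (A ⊗₀ (I ⊗₀ A))
    middle = α⇒ ∘ (σ ⊗₁ id) ∘ α⇐

    middle∘λ⇐ : middle ∘ λ⇐ ≡ id ⊗₁ λ⇐
    middle∘λ⇐ = begin
      (α⇒ ∘ (σ ⊗₁ id) ∘ α⇐) ∘ λ⇐   ≡⟨ pullʳ (pullʳ α⇐∘λ⇐) ⟩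
      α⇒ ∘ (σ ⊗₁ id) ∘ (λ⇐ ⊗₁ id)  ≡⟨ refl⟩∘⟨ sym ⊗-∘ˡ ⟩
      α⇒ ∘ ((σ ∘ λ⇐) ⊗₁ id)        ≡⟨ refl⟩∘⟨ cong (_⊗₁ id) σ∘λ⇐ ⟩
      α⇒ ∘ (ρ⇐ ⊗₁ id)              ≡⟨ α⇒∘ρ⇐⊗id ⟩
      id ⊗₁ λ⇐                     ∎

  Δ∘λ⇐ : Δ ∘ λ⇐ {A} ≡ (λ⇐ ⊗₁ λ⇐) ∘ Δ
  Δ∘λ⇐ = begin
    Δ ∘ λ⇐                                        ≡⟨ Δ-⊗ ⟩∘⟨refl ⟩
    (interchange ∘ (Δ ⊗₁ Δ)) ∘ λ⇐                 ≡⟨ (refl⟩∘⟨ cong (_⊗₁ Δ) Δ-I) ⟩∘⟨refl ⟩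
    (interchange ∘ (λ⇐ ⊗₁ Δ)) ∘ λ⇐                ≡⟨ (refl⟩∘⟨ ⊗-splitˡ) ⟩∘⟨refl ⟩
    (interchange ∘ (λ⇐ ⊗₁ id) ∘ (id ⊗₁ Δ)) ∘ λ⇐   ≡⟨ pullʳ (pullʳ λ⇐-natural) ⟩
    interchange ∘ (λ⇐ ⊗₁ id) ∘ λ⇐ ∘ Δ             ≡⟨ refl⟩∘⟨ sym assoc ⟩
    interchange ∘ ((λ⇐ ⊗₁ id) ∘ λ⇐) ∘ Δ           ≡⟨ pullˡ interchange∘λ⇐ ⟩
    (λ⇐ ⊗₁ λ⇐) ∘ Δ                                ∎

  copy-swap : (d : Hom X I) (h : Hom X Y) → λ⇒ ∘ (d ⊗₁ h) ∘ Δ ≡ ρ⇒ ∘ (h ⊗₁ d) ∘ Δ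
  copy-swap d h = begin
    λ⇒ ∘ (d ⊗₁ h) ∘ Δ        ≡⟨ refl⟩∘⟨ refl⟩∘⟨ sym cocomm ⟩
    λ⇒ ∘ (d ⊗₁ h) ∘ σ ∘ Δ    ≡⟨ refl⟩∘⟨ extendʳ (sym σ-natural) ⟩
    λ⇒ ∘ σ ∘ (h ⊗₁ d) ∘ Δ    ≡⟨ pullˡ λ⇒∘σ ⟩
    ρ⇒ ∘ (h ⊗₁ d) ∘ Δ        ∎

  swap-marginal : (f : Hom A (X ⊗₀ Y)) → λ⇒ ∘ (ε ⊗₁ id) ∘ σ ∘ f ≡ ρ⇒ ∘ (id ⊗₁ ε) ∘ f
  swap-marginal f = trans (refl⟩∘⟨ extendʳ (sym σ-natural)) (pullˡ λ⇒∘σ)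

module ConditioningProperties {o ℓ} {𝒞 : CDCategory o ℓ} (E : EffectConditioning 𝒞) where
  open CDCategory 𝒞
  open EffectConditioning E
  open SymmetricMonoidalProperties smc
  open CDProperties 𝒞
  open ≡-Reasoning

  private
    variable
      A B X Y : Obj

  bend : Hom A (B ⊗₀ X) → Hom (A ⊗₀ X) B
  bend f = ρ⇒ ∘ (id ⊗₁ cap) ∘ α⇒ ∘ (f ⊗₁ id)

  bend-injective : (f g : Hom A (B ⊗₀ X)) → bend f ≡ bend g → f ≡ g
  bend-injective = cap-cancel

  bend-natural : (h : Hom B Y) (f : Hom A (B ⊗₀ X)) → bend ((h ⊗₁ id) ∘ f) ≡ h ∘ bend f
  bend-natural h f = begin
    ρ⇒ ∘ (id ⊗₁ cap) ∘ α⇒ ∘ (((h ⊗₁ id) ∘ f) ⊗₁ id)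
      ≡⟨ refl⟩∘⟨ refl⟩∘⟨ refl⟩∘⟨ ⊗-∘ˡ ⟩
    ρ⇒ ∘ (id ⊗₁ cap) ∘ α⇒ ∘ ((h ⊗₁ id) ⊗₁ id) ∘ (f ⊗₁ id)
      ≡⟨ refl⟩∘⟨ refl⟩∘⟨ extendʳ α-natural ⟩
    ρ⇒ ∘ (id ⊗₁ cap) ∘ (h ⊗₁ (id ⊗₁ id)) ∘ α⇒ ∘ (f ⊗₁ id)
      ≡⟨ refl⟩∘⟨ refl⟩∘⟨ cong (h ⊗₁_) ⊗-id ⟩∘⟨refl ⟩
    ρ⇒ ∘ (id ⊗₁ cap) ∘ (h ⊗₁ id) ∘ α⇒ ∘ (f ⊗₁ id)
      ≡⟨ refl⟩∘⟨ extendʳ (sym ⊗-commute) ⟩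
    ρ⇒ ∘ (h ⊗₁ id) ∘ (id ⊗₁ cap) ∘ α⇒ ∘ (f ⊗₁ id)
      ≡⟨ extendʳ ρ-natural ⟩
    h ∘ bend f
      ∎

  bend-∘ : (f : Hom B (Y ⊗₀ X)) (s : Hom A B) → bend (f ∘ s) ≡ bend f ∘ (s ⊗₁ id)
  bend-∘ f s = sym (pullʳ (pullʳ (pullʳ (sym ⊗-∘ˡ))))

  bend-unit : (g : Hom A (I ⊗₀ X)) → bend g ≡ cap ∘ ((λ⇒ ∘ g) ⊗₁ id)
  bend-unit g = begin
    ρ⇒ ∘ (id ⊗₁ cap) ∘ α⇒ ∘ (g ⊗₁ id)
      ≡⟨ refl⟩∘⟨ refl⟩∘⟨ refl⟩∘⟨ cong (_⊗₁ id) (trans (sym identityˡ) (pushˡ λ-isoˡ)) ⟩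
    ρ⇒ ∘ (id ⊗₁ cap) ∘ α⇒ ∘ ((λ⇐ ∘ λ⇒ ∘ g) ⊗₁ id)
      ≡⟨ refl⟩∘⟨ refl⟩∘⟨ refl⟩∘⟨ ⊗-∘ˡ ⟩
    ρ⇒ ∘ (id ⊗₁ cap) ∘ α⇒ ∘ (λ⇐ ⊗₁ id) ∘ ((λ⇒ ∘ g) ⊗₁ id)
      ≡⟨ refl⟩∘⟨ refl⟩∘⟨ pullˡ α⇒∘λ⇐⊗id ⟩
    ρ⇒ ∘ (id ⊗₁ cap) ∘ λ⇐ ∘ ((λ⇒ ∘ g) ⊗₁ id)
      ≡⟨ refl⟩∘⟨ extendʳ λ⇐-natural ⟩
    ρ⇒ ∘ λ⇐ ∘ cap ∘ ((λ⇒ ∘ g) ⊗₁ id)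
      ≡⟨ pullˡ ρ⇒∘λ⇐ ⟩
    id ∘ cap ∘ ((λ⇒ ∘ g) ⊗₁ id)
      ≡⟨ identityˡ ⟩
    cap ∘ ((λ⇒ ∘ g) ⊗₁ id)
      ∎

  ε∘bend : (f : Hom A (B ⊗₀ X)) → ε ∘ bend f ≡ cap ∘ ((λ⇒ ∘ (ε ⊗₁ id) ∘ f) ⊗₁ id)
  ε∘bend f = trans (sym (bend-natural ε f)) (bend-unit ((ε ⊗₁ id) ∘ f))

  bend-copy : (s : Hom A X) →
              bend (Δ ∘ s) ≡ λ⇒ ∘ ((cap ∘ (s ⊗₁ id)) ⊗₁ id) ∘ α⇐ ∘ (id ⊗₁ Δ)
  bend-copy s = begin
    bend (Δ ∘ s)                                            ≡⟨ bend-∘ Δ s ⟩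
    bend Δ ∘ (s ⊗₁ id)                                      ≡⟨ sym cap-snake ⟩∘⟨refl ⟩
    (λ⇒ ∘ (cap ⊗₁ id) ∘ α⇐ ∘ (id ⊗₁ Δ)) ∘ (s ⊗₁ id)        ≡⟨ pullʳ (pullʳ (pullʳ (sym ⊗-commute))) ⟩
    λ⇒ ∘ (cap ⊗₁ id) ∘ α⇐ ∘ (s ⊗₁ id) ∘ (id ⊗₁ Δ)          ≡⟨ refl⟩∘⟨ refl⟩∘⟨ refl⟩∘⟨ cong (s ⊗₁_) (sym ⊗-id) ⟩∘⟨refl ⟩
    λ⇒ ∘ (cap ⊗₁ id) ∘ α⇐ ∘ (s ⊗₁ (id ⊗₁ id)) ∘ (id ⊗₁ Δ)  ≡⟨ refl⟩∘⟨ refl⟩∘⟨ extendʳ α⇐-natural ⟩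
    λ⇒ ∘ (cap ⊗₁ id) ∘ ((s ⊗₁ id) ⊗₁ id) ∘ α⇐ ∘ (id ⊗₁ Δ)  ≡⟨ refl⟩∘⟨ pullˡ (sym ⊗-∘ˡ) ⟩
    λ⇒ ∘ ((cap ∘ (s ⊗₁ id)) ⊗₁ id) ∘ α⇐ ∘ (id ⊗₁ Δ)        ∎

  bend-copy-state : ∀ {X} (s : Hom I X) →
                    bend (Δ ∘ s) ∘ λ⇐ ≡ λ⇒ ∘ (((cap ∘ (s ⊗₁ id)) ∘ λ⇐) ⊗₁ id) ∘ Δ
  bend-copy-state {X} s = begin
    bend (Δ ∘ s) ∘ λ⇐                                ≡⟨ bend-copy s ⟩∘⟨refl ⟩
    (λ⇒ ∘ (e ⊗₁ id) ∘ α⇐ ∘ (id ⊗₁ Δ)) ∘ λ⇐           ≡⟨ pullʳ (pullʳ (pullʳ λ⇐-natural)) ⟩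
    λ⇒ ∘ (e ⊗₁ id) ∘ α⇐ ∘ λ⇐ ∘ Δ                     ≡⟨ refl⟩∘⟨ refl⟩∘⟨ pullˡ α⇐∘λ⇐ ⟩
    λ⇒ ∘ (e ⊗₁ id) ∘ (λ⇐ ⊗₁ id) ∘ Δ                  ≡⟨ refl⟩∘⟨ pullˡ (sym ⊗-∘ˡ) ⟩
    λ⇒ ∘ ((e ∘ λ⇐) ⊗₁ id) ∘ Δ                        ∎
    where
    e : Hom (I ⊗₀ X) I
    e = cap ∘ (s ⊗₁ id)

  norm-factor-λ⇐ : (g : Hom (I ⊗₀ X) Y) →
                   g ∘ λ⇐ ≡ ρ⇒ ∘ ((norm g ∘ λ⇐) ⊗₁ ((ε ∘ g) ∘ λ⇐)) ∘ Δ
  norm-factor-λ⇐ g = begin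
    g ∘ λ⇐                                          ≡⟨ norm-factor g ⟩∘⟨refl ⟩
    (ρ⇒ ∘ (norm g ⊗₁ (ε ∘ g)) ∘ Δ) ∘ λ⇐             ≡⟨ pullʳ (pullʳ Δ∘λ⇐) ⟩
    ρ⇒ ∘ (norm g ⊗₁ (ε ∘ g)) ∘ (λ⇐ ⊗₁ λ⇐) ∘ Δ       ≡⟨ refl⟩∘⟨ pullˡ (sym ⊗-∘) ⟩
    ρ⇒ ∘ ((norm g ∘ λ⇐) ⊗₁ ((ε ∘ g) ∘ λ⇐)) ∘ Δ      ∎

  state-disintegration : ∀ {X Y} (τ : Hom I (Y ⊗₀ X)) →
                         τ ≡ (stateConditional τ ⊗₁ id) ∘ Δ ∘ λ⇒ ∘ (ε ⊗₁ id) ∘ τ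
  state-disintegration {X} {Y} τ = bend-injective τ ((h ⊗₁ id) ∘ Δ ∘ s) (split-epi-cancel λ-isoˡ (begin
    bend τ ∘ λ⇐                                ≡⟨ norm-factor-λ⇐ (bend τ) ⟩
    ρ⇒ ∘ (h ⊗₁ ((ε ∘ bend τ) ∘ λ⇐)) ∘ Δ        ≡⟨ refl⟩∘⟨ cong (h ⊗₁_) (ε∘bend τ ⟩∘⟨refl) ⟩∘⟨refl ⟩
    ρ⇒ ∘ (h ⊗₁ d) ∘ Δ                          ≡⟨ sym (copy-swap d h) ⟩
    λ⇒ ∘ (d ⊗₁ h) ∘ Δ                          ≡⟨ refl⟩∘⟨ pushˡ (sym ⊗-splitʳ) ⟩
    λ⇒ ∘ (id ⊗₁ h) ∘ (d ⊗₁ id) ∘ Δ             ≡⟨ extendʳ λ-natural ⟩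
    h ∘ λ⇒ ∘ (d ⊗₁ id) ∘ Δ                     ≡⟨ refl⟩∘⟨ sym (bend-copy-state s) ⟩
    h ∘ bend (Δ ∘ s) ∘ λ⇐                      ≡⟨ pullˡ (sym (bend-natural h (Δ ∘ s))) ⟩
    bend ((h ⊗₁ id) ∘ Δ ∘ s) ∘ λ⇐              ∎))
    where
    h : Hom X Y
    h = stateConditional τ
    s : Hom I X
    s = λ⇒ ∘ (ε ⊗₁ id) ∘ τ
    d : Hom X I
    d = (cap ∘ (s ⊗₁ id)) ∘ λ⇐

lemma2p12 : ∀ {o ℓ : Level} (C : CDCategory o ℓ) (E : EffectConditioning C) →
    let open CDCategory C
        open EffectConditioning E
    in ∀ {X Y : Obj} (ω : Hom I (X ⊗₀ Y)) →
      ω ≡ (id ⊗₁ stateConditional (σ ∘ ω)) ∘ Δ ∘ marginal ω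
lemma2p12 C E {X} {Y} ω = begin
  ω                                            ≡⟨ trans (sym identityˡ) (pushˡ σ-involutive) ⟩
  σ ∘ σ ∘ ω                                    ≡⟨ refl⟩∘⟨ state-disintegration (σ ∘ ω) ⟩
  σ ∘ (h ⊗₁ id) ∘ Δ ∘ λ⇒ ∘ (ε ⊗₁ id) ∘ σ ∘ ω   ≡⟨ extendʳ σ-natural ⟩
  (id ⊗₁ h) ∘ σ ∘ Δ ∘ λ⇒ ∘ (ε ⊗₁ id) ∘ σ ∘ ω   ≡⟨ refl⟩∘⟨ pullˡ cocomm ⟩
  (id ⊗₁ h) ∘ Δ ∘ λ⇒ ∘ (ε ⊗₁ id) ∘ σ ∘ ω       ≡⟨ refl⟩∘⟨ refl⟩∘⟨ swap-marginal ω ⟩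
  (id ⊗₁ h) ∘ Δ ∘ marginal ω                   ∎
  where
  open CDCategory C
  open EffectConditioning E
  open SymmetricMonoidalProperties smc
  open CDProperties C
  open ConditioningProperties E
  open ≡-Reasoning
  h : Hom X Y
  h = stateConditional (σ ∘ ω)
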